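{- Let $n\geq1$. For $\mathsf{S}\subseteq[n-1]$ let $Z(\mathsf{S})\in\mathfrak{S}_n$ be the maximal permutation (in the weak order) with descent set $\mathsf{S}$, and for $u\in\mathfrak{S}_n$ let $\mathrm{GDes}(u)\subseteq[n-1]$ be its set of global descents. Then the pair of maps $(Z,\mathrm{GDes})$, with $Z\colon\mathcal{Q}_n\to\mathfrak{S}_n$ and $\mathrm{GDes}\colon\mathfrak{S}_n\to\mathcal{Q}_n$, is a Galois connection: both maps are order preserving and for all $\mathsf{S}\in\mathcal{Q}_n$ and $u\in\mathfrak{S}_n$, \[Z(\mathsf{S})\leq u\iff \mathsf{S}\subseteq\mathrm{GDes}(u).\]
   Context: $\mathfrak{S}_n$ is the symmetric group on $[n]$; $u$ is written as the word $u_1\cdots u_n$ with $u_i=u(i)$; permutations multiply as functions. $\ell(u)=\#\{i<j\mid u_i>u_j\}$. Weak order: $u\leq v$ iff $v=wu$ for some $w$ with $\ell(v)=\ell(w)+\ell(u)$. The descent set of $u$ is $\mathrm{Des}(u)=\{p\in[n-1]\mid u_p>u_{p+1}\}$. A permutation $u\in\mathfrak{S}_n$ has a global descent at $p\in[n-1]$ if $u_i>u_j$ whenever $i\leq p<j$ (equivalently $\{u_1,\dots,u_p\}=\{n,n-1,\dots,n-p+1\}$); $\mathrm{GDes}(u)$ is the set of such $p$. $\mathcal{Q}_n$ is the Boolean poset of subsets of $[n-1]$ under inclusion. A Galois connection between posets $P,Q$ is a pair of order preserving maps $f\colon P\to Q$, $g\colon Q\to P$ with $f(x)\leq y\iff x\leq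 g(y)$. -}

module Defs where

open import Data.Nat using (ℕ; suc; _+_)
open import Data.Bool using (Bool)
open import Data.Fin using (Fin; suc; inject₁; _<_; _≤_; _<?_; _≤?_)
open import Data.Fin.Properties using (all?)
open import Data.Fin.Permutation using (Permutation′; _⟨$⟩ʳ_)
open import Data.Fin.Subset using (Subset)
open import Data.Vec using (tabulate)
open import Data.List using (List; length; filter; cartesianProduct; allFin)
open import Data.Product using (Σ; _×_; _,_)
open import Data.Product.Properties using ()
open import Relation.Nullary using (Dec; does; _×-dec_; _→-dec_)
open import Relation.Binary.PropositionalEquality using (_≡_)

-- Permutations of [n] are permutations of Fin n; u i is u(i) (0-based).
Perm : ℕ → Set
Perm n = Permutation′ n

Inv : ∀ {n} → Perm n → Fin n × Fin n → Set
Inv u (i , j) = (i < j) × (u ⟨$⟩ʳ j < u ⟨$⟩ʳ i)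

inv? : ∀ {n} (u : Perm n) (p : Fin n × Fin n) → Dec (Inv u p)
inv? u (i , j) = (i <? j) ×-dec ((u ⟨$⟩ʳ j) <? (u ⟨$⟩ʳ i))

len : ∀ {n} → Perm n → ℕ
len {n} u = length (filter (inv? u) (cartesianProduct (allFin n) (allFin n)))

_≤W_ : ∀ {n} → Perm n → Perm n → Set
_≤W_ {n} u v = Σ (Perm n) λ w →
  ((i : Fin n) → v ⟨$⟩ʳ i ≡ w ⟨$⟩ʳ (u ⟨$⟩ʳ i)) × (len v ≡ len w + len u)

-- For n = suc m, [n-1] is represented by Fin m: index k stands for position p = k+1,
-- comparing (0-based) positions inject₁ k and suc k.
Des : ∀ {m} → Perm (suc m) → Subset m
Des u = tabulate λ k → does ((u ⟨$⟩ʳ suc k) <? (u ⟨$⟩ʳ inject₁ k))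

IsGDes : ∀ {m} → Perm (suc m) → Fin m → Set
IsGDes u k = (i j : Fin _) → i ≤ inject₁ k → inject₁ k < j → u ⟨$⟩ʳ j < u ⟨$⟩ʳ i

isGDes? : ∀ {m} (u : Perm (suc m)) (k : Fin m) → Dec (IsGDes u k)
isGDes? u k = all? λ i → all? λ j →
  (i ≤? inject₁ k) →-dec ((inject₁ k <? j) →-dec ((u ⟨$⟩ʳ j) <? (u ⟨$⟩ʳ i)))

GDes : ∀ {m} → Perm (suc m) → Subset m
GDes u = tabulate λ k → does (isGDes? u k)

IsMaxWithDes : ∀ {m} → Subset m → Perm (suc m) → Set
IsMaxWithDes {m} S z = (Des z ≡ S) × ((u : Perm (suc m)) → Des u ≡ S → u ≤W z)

-- Weak order is inclusion of inversion sets: if v = w ∘ u, then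
-- ℓ(v) + 2·#{inversions of u that w undoes} = ℓ(u) + ℓ(w), so ℓ(v) = ℓ(w) + ℓ(u) exactly when
-- every inversion of u is an inversion of v.  A permutation with descent set S can only invert
-- pairs i < j separated by some element of S (between them lies a descent), and Z(S) inverts all
-- of them.  Hence Z(S) ≤ u iff u inverts every pair separated by S, i.e. iff every element of S is
-- a global descent of u; monotonicity of Z and of GDes follows.
module Submission where

open import Defs
open import Level using (Level; 0ℓ)
open import Data.Bool.Base using (Bool; true; false; if_then_else_)
open import Data.Empty using (⊥-elim)
open import Data.Nat.Base as ℕ using (ℕ; zero; suc; _+_; z≤n; s≤s)
import Data.Nat.Properties as ℕ
open import Data.Fin using (Fin; zero; suc; toℕ; inject₁; fromℕ; punchIn; _≤_; _<_; _<?_)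
import Data.Fin.Properties as Fin
open import Data.Fin.Permutation as Permutation using (_⟨$⟩ʳ_; flip; _∘ₚ_; inverseˡ; insert)
open import Data.Fin.Subset using (Subset; _∈_; _⊆_)
import Data.Fin.Subset.Properties as Subset
open import Data.Vec.Base as Vec using ([]; _∷_; here; there)
import Data.Vec.Properties as Vec
open import Data.List.Base as List using (List; length; filter; cartesianProduct; allFin; map; _++_)
import Data.List.Properties as List
open import Data.Product.Base using (Σ; _×_; _,_; proj₁; proj₂)
open import Function.Base using (_∘_; id)
open import Function.Bundles using (_⇔_; mk⇔; Equivalence; Injection)
open Equivalence using (to; from)
open import Function.Properties.Equivalence using () renaming (trans to ⇔-trans; sym to ⇔-sym)
open import Function.Properties.Inverse using (↔⇒↣)
open import Relation.Binary.Definitions using (tri<; tri≈; tri>)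
open import Relation.Binary.PropositionalEquality
open import Relation.Nullary using (Dec; yes; no; ¬_; does; _×-dec_; contradiction)
open import Relation.Nullary.Decidable using (dec-true; dec-false; does-⇔)
open import Relation.Unary as U using (Pred; Decidable)
open import Algebra.Properties.CommutativeMonoid.Sum ℕ.+-0-commutativeMonoid
  using (sum; sum-cong-≗; ∑-distrib-+; ∑-comm; ∑-permute; sum-remove; sum-replicate-zero)

private
  variable
    a p : Level
    A : Set a
    P Q : Set p
    m n : ℕ

χ : Dec P → ℕ
χ d = if does d then 1 else 0

χ-yes : (d : Dec P) → P → χ d ≡ 1
χ-yes d x = cong (if_then 1 else 0) (dec-true d x)

χ-no : (d : Dec P) → ¬ P → χ d ≡ 0
χ-no d ¬x = cong (if_then 1 else 0) (dec-false d ¬x)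

χ-cong : P ⇔ Q → (d : Dec P) (e : Dec Q) → χ d ≡ χ e
χ-cong P⇔Q d e = cong (if_then 1 else 0) (does-⇔ P⇔Q d e)

sum≡0⇒≡0 : (f : Fin n → ℕ) → sum f ≡ 0 → ∀ i → f i ≡ 0
sum≡0⇒≡0 {suc n} f ∑f≡0 i = ℕ.m+n≡0⇒m≡0 (f i) (trans (sym (sum-remove f)) ∑f≡0)

∑∑ : (Fin n → Fin n → ℕ) → ℕ
∑∑ f = sum λ i → sum λ j → f i j

∑∑-cong : {f g : Fin n → Fin n → ℕ} → (∀ i j → f i j ≡ g i j) → ∑∑ f ≡ ∑∑ g
∑∑-cong f≗g = sum-cong-≗ λ i → sum-cong-≗ (f≗g i)

∑∑-distrib-+ : (f g : Fin n → Fin n → ℕ) → ∑∑ (λ i j → f i j + g i j) ≡ ∑∑ f + ∑∑ g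
∑∑-distrib-+ f g =
  trans (sum-cong-≗ λ i → ∑-distrib-+ (f i) (g i)) (∑-distrib-+ (λ i → sum (f i)) (λ i → sum (g i)))

∑∑-transpose : (f : Fin n → Fin n → ℕ) → ∑∑ f ≡ ∑∑ (λ i j → f j i)
∑∑-transpose = ∑-comm

∑∑-permute : (f : Fin n → Fin n → ℕ) (π : Perm n) → ∑∑ f ≡ ∑∑ (λ i j → f (π ⟨$⟩ʳ i) (π ⟨$⟩ʳ j))
∑∑-permute f π = trans (∑-permute (λ x → sum (f x)) π) (sum-cong-≗ λ i → ∑-permute (f (π ⟨$⟩ʳ i)) π)

∑∑-zero : {f : Fin n → Fin n → ℕ} → (∀ i j → f i j ≡ 0) → ∑∑ f ≡ 0
∑∑-zero {n} f≗0 =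
  trans (∑∑-cong f≗0) (trans (sum-cong-≗ {n} λ _ → sum-replicate-zero n) (sum-replicate-zero n))

∑∑≡0⇒≡0 : (f : Fin n → Fin n → ℕ) → ∑∑ f ≡ 0 → ∀ i j → f i j ≡ 0
∑∑≡0⇒≡0 f ∑∑f≡0 i = sum≡0⇒≡0 (f i) (sum≡0⇒≡0 _ ∑∑f≡0 i)

length-filter-tabulate : {P : Pred A p} (P? : Decidable P) (f : Fin n → A) →
  length (filter P? (List.tabulate f)) ≡ sum (λ i → χ (P? (f i)))
length-filter-tabulate {n = zero}  P? f = refl
length-filter-tabulate {n = suc n} P? f with does (P? (f zero))
... | true  = cong suc (length-filter-tabulate P? (f ∘ suc))
... | false = length-filter-tabulate P? (f ∘ suc)

length-filter-cartesianProduct : ∀ {k n} {P : Pred (Fin n × Fin n) p} (P? : Decidable P) (f : Fin k → Fin n) →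
  length (filter P? (cartesianProduct (List.tabulate f) (allFin n)))
    ≡ sum (λ i → sum (λ j → χ (P? (f i , j))))
length-filter-cartesianProduct {k = zero}  P? f = refl
length-filter-cartesianProduct {k = suc k} {n = n} P? f = begin
  length (filter P? (row ++ rest))
    ≡⟨ cong length (List.filter-++ P? row rest) ⟩
  length (filter P? row ++ filter P? rest)
    ≡⟨ List.length-++ (filter P? row) ⟩
  length (filter P? row) + length (filter P? rest)
    ≡⟨ cong₂ _+_ (trans (cong (length ∘ filter P?) (List.map-tabulate id (f zero ,_)))
                        (length-filter-tabulate P? (f zero ,_)))
                 (length-filter-cartesianProduct P? (f ∘ suc)) ⟩
  _ ∎
  where
  open ≡-Reasoning
  row rest : List (Fin n × Fin n)
  row = map (f zero ,_) (allFin n)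
  rest = cartesianProduct (List.tabulate (f ∘ suc)) (allFin n)

χInv : Perm n → Fin n → Fin n → ℕ
χInv u i j = χ (inv? u (i , j))

len≡∑∑χInv : (u : Perm n) → len u ≡ ∑∑ (χInv u)
len≡∑∑χInv u = length-filter-cartesianProduct (inv? u) id

⟨$⟩ʳ-injective : (π : Perm n) {i j : Fin n} → π ⟨$⟩ʳ i ≡ π ⟨$⟩ʳ j → i ≡ j
⟨$⟩ʳ-injective π = Injection.injective (↔⇒↣ π)

module Factorisation (u w v : Perm n) (v≗w∘u : ∀ i → v ⟨$⟩ʳ i ≡ w ⟨$⟩ʳ (u ⟨$⟩ʳ i)) where

  Created Undone : Fin n → Fin n → Set
  Created i j = i < j × Inv w (u ⟨$⟩ʳ i , u ⟨$⟩ʳ j)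
  Undone  i j = i < j × Inv w (u ⟨$⟩ʳ j , u ⟨$⟩ʳ i)

  created? : ∀ i j → Dec (Created i j)
  created? i j = (i <? j) ×-dec inv? w (u ⟨$⟩ʳ i , u ⟨$⟩ʳ j)

  undone? : ∀ i j → Dec (Undone i j)
  undone? i j = (i <? j) ×-dec inv? w (u ⟨$⟩ʳ j , u ⟨$⟩ʳ i)

  χCreated χUndone : Fin n → Fin n → ℕ
  χCreated i j = χ (created? i j)
  χUndone  i j = χ (undone? i j)

  created undone : ℕ
  created = ∑∑ χCreated
  undone  = ∑∑ χUndone

  private
    W : Fin n → Fin n
    W i = w ⟨$⟩ʳ (u ⟨$⟩ʳ i)

  inv-v : ∀ {i j} → i < j → W j < W i → Inv v (i , j)
  inv-v {i} {j} i<j Wj<Wi = i<j , subst₂ _<_ (sym (v≗w∘u j)) (sym (v≗w∘u i)) Wj<Wi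

  inv-v⁻¹ : ∀ {i j} → Inv v (i , j) → W j < W i
  inv-v⁻¹ {i} {j} (_ , vj<vi) = subst₂ _<_ (v≗w∘u j) (v≗w∘u i) vj<vi

  -- For i < j both sides are 1 exactly when u or w ∘ u inverts (i , j).
  χInv-v+χUndone : ∀ i j → χInv v i j + χUndone i j ≡ χInv u i j + χCreated i j
  χInv-v+χUndone i j with i <? j
  ... | no i≮j = trans
    (cong₂ _+_ (χ-no (inv? v _) (i≮j ∘ proj₁)) (χ-no (undone? i j) (i≮j ∘ proj₁)))
    (sym (cong₂ _+_ (χ-no (inv? u _) (i≮j ∘ proj₁)) (χ-no (created? i j) (i≮j ∘ proj₁))))
  ... | yes i<j with Fin.<-cmp (u ⟨$⟩ʳ i) (u ⟨$⟩ʳ j) | Fin.<-cmp (W i) (W j)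
  ... | tri≈ _ ui≡uj _ | _ = contradiction (⟨$⟩ʳ-injective u ui≡uj) (Fin.<⇒≢ i<j)
  ... | _ | tri≈ _ Wi≡Wj _ = contradiction (⟨$⟩ʳ-injective u (⟨$⟩ʳ-injective w Wi≡Wj)) (Fin.<⇒≢ i<j)
  ... | tri< ui<uj _ _ | tri< Wi<Wj _ _ = trans
    (cong₂ _+_ (χ-no (inv? v _) (Fin.<-asym Wi<Wj ∘ inv-v⁻¹))
               (χ-no (undone? i j) (Fin.<-asym ui<uj ∘ proj₁ ∘ proj₂)))
    (sym (cong₂ _+_ (χ-no (inv? u _) (Fin.<-asym ui<uj ∘ proj₂))
                    (χ-no (created? i j) (Fin.<-asym Wi<Wj ∘ proj₂ ∘ proj₂))))
  ... | tri< ui<uj _ _ | tri> _ _ Wj<Wi = trans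
    (cong₂ _+_ (χ-yes (inv? v _) (inv-v i<j Wj<Wi))
               (χ-no (undone? i j) (Fin.<-asym ui<uj ∘ proj₁ ∘ proj₂)))
    (sym (cong₂ _+_ (χ-no (inv? u _) (Fin.<-asym ui<uj ∘ proj₂))
                    (χ-yes (created? i j) (i<j , ui<uj , Wj<Wi))))
  ... | tri> _ _ uj<ui | tri< Wi<Wj _ _ = trans
    (cong₂ _+_ (χ-no (inv? v _) (Fin.<-asym Wi<Wj ∘ inv-v⁻¹))
               (χ-yes (undone? i j) (i<j , uj<ui , Wi<Wj)))
    (sym (cong₂ _+_ (χ-yes (inv? u _) (i<j , uj<ui))
                    (χ-no (created? i j) (Fin.<-asym uj<ui ∘ proj₁ ∘ proj₂))))
  ... | tri> _ _ uj<ui | tri> _ _ Wj<Wi = trans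
    (cong₂ _+_ (χ-yes (inv? v _) (inv-v i<j Wj<Wi))
               (χ-no (undone? i j) (Fin.<-asym Wj<Wi ∘ proj₂ ∘ proj₂)))
    (sym (cong₂ _+_ (χ-yes (inv? u _) (i<j , uj<ui))
                    (χ-no (created? i j) (Fin.<-asym uj<ui ∘ proj₁ ∘ proj₂))))

  χInv-w∘u : ∀ i j → χInv w (u ⟨$⟩ʳ i) (u ⟨$⟩ʳ j) ≡ χCreated i j + χUndone j i
  χInv-w∘u i j with Fin.<-cmp i j
  ... | tri< i<j _ j≮i = trans (χ-cong (mk⇔ (i<j ,_) proj₂) (inv? w _) (created? i j))
                               (sym (trans (cong (χCreated i j +_) (χ-no (undone? j i) (j≮i ∘ proj₁)))
                                           (ℕ.+-identityʳ (χCreated i j))))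
  ... | tri> i≮j _ j<i = trans (χ-cong (mk⇔ (j<i ,_) proj₂) (inv? w _) (undone? j i))
                               (sym (cong (_+ χUndone j i) (χ-no (created? i j) (i≮j ∘ proj₁))))
  ... | tri≈ _ refl _ = trans (χ-no (inv? w _) (Fin.<-irrefl refl ∘ proj₁))
                              (sym (cong₂ _+_ (χ-no (created? i i) (Fin.<-irrefl refl ∘ proj₁))
                                              (χ-no (undone? i i) (Fin.<-irrefl refl ∘ proj₁))))

  len-w : len w ≡ created + undone
  len-w = begin
    len w                                                ≡⟨ len≡∑∑χInv w ⟩
    ∑∑ (χInv w)                                          ≡⟨ ∑∑-permute (χInv w) u ⟩
    ∑∑ (λ i j → χInv w (u ⟨$⟩ʳ i) (u ⟨$⟩ʳ j))            ≡⟨ ∑∑-cong χInv-w∘u ⟩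
    ∑∑ (λ i j → χCreated i j + χUndone j i)              ≡⟨ ∑∑-distrib-+ χCreated (λ i j → χUndone j i) ⟩
    created + ∑∑ (λ i j → χUndone j i)                   ≡⟨ cong (created +_) (∑∑-transpose χUndone) ⟨
    created + undone                                     ∎
    where open ≡-Reasoning

  len-v : len v + undone ≡ len u + created
  len-v = begin
    len v + undone                                ≡⟨ cong (_+ undone) (len≡∑∑χInv v) ⟩
    ∑∑ (χInv v) + undone                          ≡⟨ ∑∑-distrib-+ (χInv v) χUndone ⟨
    ∑∑ (λ i j → χInv v i j + χUndone i j)         ≡⟨ ∑∑-cong χInv-v+χUndone ⟩
    ∑∑ (λ i j → χInv u i j + χCreated i j)        ≡⟨ ∑∑-distrib-+ (χInv u) χCreated ⟩
    ∑∑ (χInv u) + created                         ≡⟨ cong (_+ created) (len≡∑∑χInv u) ⟨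
    len u + created                               ∎
    where open ≡-Reasoning

  len-v+2undone : len v + (undone + undone) ≡ len w + len u
  len-v+2undone = begin
    len v + (undone + undone)   ≡⟨ ℕ.+-assoc (len v) undone undone ⟨
    len v + undone + undone     ≡⟨ cong (_+ undone) len-v ⟩
    len u + created + undone    ≡⟨ ℕ.+-assoc (len u) created undone ⟩
    len u + (created + undone)  ≡⟨ cong (len u +_) len-w ⟨
    len u + len w               ≡⟨ ℕ.+-comm (len u) (len w) ⟩
    len w + len u               ∎
    where open ≡-Reasoning

  additive⇒¬Undone : len v ≡ len w + len u → ∀ i j → ¬ Undone i j
  additive⇒¬Undone additive i j undone-ij =
    ℕ.1+n≢0 (trans (sym (χ-yes (undone? i j) undone-ij)) χUndone≡0)
    where
    undone≡0 : undone ≡ 0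
    undone≡0 = ℕ.m+n≡0⇒m≡0 undone (ℕ.+-cancelˡ-≡ (len v) _ 0
      (trans len-v+2undone (trans (sym additive) (sym (ℕ.+-identityʳ (len v))))))
    χUndone≡0 : χUndone i j ≡ 0
    χUndone≡0 = ∑∑≡0⇒≡0 χUndone undone≡0 i j

  ¬Undone⇒additive : (∀ i j → ¬ Undone i j) → len v ≡ len w + len u
  ¬Undone⇒additive ¬undone = begin
    len v                      ≡⟨ ℕ.+-identityʳ (len v) ⟨
    len v + 0                  ≡⟨ cong (λ x → len v + (x + x)) undone≡0 ⟨
    len v + (undone + undone)  ≡⟨ len-v+2undone ⟩
    len w + len u              ∎
    where
    open ≡-Reasoning
    undone≡0 : undone ≡ 0
    undone≡0 = ∑∑-zero λ i j → χ-no (undone? i j) (¬undone i j)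

  Inv⊆⇒¬Undone : Inv u U.⊆ Inv v → ∀ i j → ¬ Undone i j
  Inv⊆⇒¬Undone u⊆v i j (i<j , uj<ui , Wi<Wj) = Fin.<-asym Wi<Wj (inv-v⁻¹ (u⊆v (i<j , uj<ui)))

  ¬Undone⇒Inv⊆ : (∀ i j → ¬ Undone i j) → Inv u U.⊆ Inv v
  ¬Undone⇒Inv⊆ ¬undone {i , j} (i<j , uj<ui) with Fin.<-cmp (W i) (W j)
  ... | tri< Wi<Wj _ _ = contradiction (i<j , uj<ui , Wi<Wj) (¬undone i j)
  ... | tri≈ _ Wi≡Wj _ = contradiction (⟨$⟩ʳ-injective u (⟨$⟩ʳ-injective w Wi≡Wj)) (Fin.<⇒≢ i<j)
  ... | tri> _ _ Wj<Wi = inv-v i<j Wj<Wi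

≤W⇔Inv⊆ : (u v : Perm n) → u ≤W v ⇔ Inv u U.⊆ Inv v
≤W⇔Inv⊆ u v = mk⇔ ≤W⇒Inv⊆ Inv⊆⇒≤W
  where
  ≤W⇒Inv⊆ : u ≤W v → Inv u U.⊆ Inv v
  ≤W⇒Inv⊆ (w , v≗w∘u , additive) = ¬Undone⇒Inv⊆ (additive⇒¬Undone additive)
    where open Factorisation u w v v≗w∘u

  Inv⊆⇒≤W : Inv u U.⊆ Inv v → u ≤W v
  Inv⊆⇒≤W u⊆v = w , v≗w∘u , ¬Undone⇒additive (Inv⊆⇒¬Undone u⊆v)
    where
    w : Perm _
    w = flip u ∘ₚ v
    v≗w∘u : ∀ i → v ⟨$⟩ʳ i ≡ w ⟨$⟩ʳ (u ⟨$⟩ʳ i)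
    v≗w∘u i = cong (v ⟨$⟩ʳ_) (sym (inverseˡ u))
    open Factorisation u w v v≗w∘u

descent-between : (f : Fin (suc m) → Fin n) {i j : Fin (suc m)} → i < j → f j < f i →
  Σ (Fin m) λ k → i ≤ inject₁ k × inject₁ k < j × f (suc k) < f (inject₁ k)
descent-between f {zero}  {suc zero}    _ fj<fi = zero , z≤n , s≤s z≤n , fj<fi
descent-between {m = suc m} f {zero}  {suc (suc j)} _ fj<fi with f (suc zero) <? f zero
... | yes f1<f0 = zero , z≤n , s≤s z≤n , f1<f0
... | no  f1≮f0 with descent-between (f ∘ suc) {zero} {suc j} (s≤s z≤n) (ℕ.<-≤-trans fj<fi (ℕ.≮⇒≥ f1≮f0))
...   | k , _ , k<j , descent = suc k , z≤n , s≤s k<j , descent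
descent-between {m = suc m} f {suc i} {suc j} (s≤s i<j) fj<fi with descent-between (f ∘ suc) i<j fj<fi
... | k , i≤k , k<j , descent = suc k , s≤s i≤k , s≤s k<j , descent

∈-tabulate-does : {P : Pred (Fin n) p} (P? : Decidable P) {k : Fin n} → k ∈ Vec.tabulate (does ∘ P?) ⇔ P k
∈-tabulate-does P? {k} = mk⇔
  (λ k∈ → does≡true⇒ (P? k) (trans (sym (Vec.lookup∘tabulate (does ∘ P?) k)) (Vec.[]=⇒lookup k∈)))
  (λ Pk → Vec.lookup⇒[]= k _ (trans (Vec.lookup∘tabulate (does ∘ P?) k) (dec-true (P? k) Pk)))
  where
  does≡true⇒ : (d : Dec Q) → does d ≡ true → Q
  does≡true⇒ (yes q) _ = q

∈Des⇔ : (u : Perm (suc m)) {k : Fin m} → k ∈ Des u ⇔ u ⟨$⟩ʳ suc k < u ⟨$⟩ʳ inject₁ k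
∈Des⇔ u = ∈-tabulate-does λ k → (u ⟨$⟩ʳ suc k) <? (u ⟨$⟩ʳ inject₁ k)

∈GDes⇔ : (u : Perm (suc m)) {k : Fin m} → k ∈ GDes u ⇔ IsGDes u k
∈GDes⇔ u = ∈-tabulate-does (isGDes? u)

data Separated (S : Subset m) : Pred (Fin (suc m) × Fin (suc m)) 0ℓ where
  separated : ∀ {i j} k → k ∈ S → i ≤ inject₁ k → inject₁ k < j → Separated S (i , j)

separated⇒< : {S : Subset m} {i j : Fin (suc m)} → Separated S (i , j) → i < j
separated⇒< (separated _ _ i≤k k<j) = ℕ.≤-<-trans i≤k k<j

Inv⊆Separated-Des : (u : Perm (suc m)) → Inv u U.⊆ Separated (Des u)
Inv⊆Separated-Des u (i<j , uj<ui) with descent-between (u ⟨$⟩ʳ_) i<j uj<ui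
... | k , i≤k , k<j , descent = separated k (from (∈Des⇔ u) descent) i≤k k<j

Separated⊆Inv⇔⊆GDes : (S : Subset m) (u : Perm (suc m)) → (Separated S U.⊆ Inv u) ⇔ (S ⊆ GDes u)
Separated⊆Inv⇔⊆GDes S u = mk⇔
  (λ S⊆Inv {k} k∈S → from (∈GDes⇔ u) λ i j i≤k k<j → proj₂ (S⊆Inv (separated k k∈S i≤k k<j)))
  (λ S⊆GDes → λ { {i , j} (separated k k∈S i≤k k<j) →
      ℕ.≤-<-trans i≤k k<j , to (∈GDes⇔ u) (S⊆GDes k∈S) i j i≤k k<j })

separated-adjacent⇔ : {S : Subset m} {k : Fin m} → Separated S (inject₁ k , suc k) ⇔ k ∈ S
separated-adjacent⇔ {S = S} {k} = mk⇔
  (λ { (separated k′ k′∈S k≤k′ k′<k+1) → subst (_∈ S) (k′≡k k≤k′ k′<k+1) k′∈S })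
  (λ k∈S → separated k k∈S Fin.≤-refl (Fin.≤̄⇒inject₁< Fin.≤-refl))
  where
  k′≡k : ∀ {k′} → inject₁ k ≤ inject₁ k′ → inject₁ k′ < suc k → k′ ≡ k
  k′≡k k≤k′ k′<k+1 = Fin.inject₁-injective (Fin.≤-antisym (Fin.<⇒≤pred k′<k+1) k≤k′)

separated-suc⇔ : {S : Subset m} {b : Bool} {i j : Fin (suc m)} →
  Separated (b ∷ S) (suc i , suc j) ⇔ Separated S (i , j)
separated-suc⇔ = mk⇔
  (λ { (separated (suc k) (there k∈S) (s≤s i≤k) (s≤s k<j)) → separated k k∈S i≤k k<j })
  (λ { (separated k k∈S i≤k k<j) → separated (suc k) (there k∈S) (s≤s i≤k) (s≤s k<j) })

separated-zero⇔ : {S : Subset m} {j : Fin (suc m)} →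
  Separated (false ∷ S) (zero , suc j) ⇔ Separated S (zero , j)
separated-zero⇔ = mk⇔
  (λ { (separated (suc k) (there k∈S) _ (s≤s k<j)) → separated k k∈S z≤n k<j })
  (λ { (separated k k∈S _ k<j) → separated (suc k) (there k∈S) z≤n (s≤s k<j) })

punchIn-<⇔ : (c : Fin (suc n)) {x y : Fin n} → punchIn c x < punchIn c y ⇔ x < y
punchIn-<⇔ c {x} {y} = mk⇔
  (λ cx<cy → Fin.≤∧≢⇒< (Fin.punchIn-cancel-≤ c x y (ℕ.<⇒≤ cx<cy)) λ { refl → Fin.<-irrefl refl cx<cy })
  (λ x<y → Fin.≤∧≢⇒< (Fin.punchIn-mono-≤ c x y (ℕ.<⇒≤ x<y)) (Fin.<⇒≢ x<y ∘ Fin.punchIn-injective c x y))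

punchIn-<-pivot⇔ : (c : Fin (suc n)) (x : Fin n) → punchIn c x < c ⇔ x < c
punchIn-<-pivot⇔ zero    x       = mk⇔ (λ ()) (λ ())
punchIn-<-pivot⇔ (suc c) zero    = mk⇔ (λ _ → s≤s z≤n) (λ _ → s≤s z≤n)
punchIn-<-pivot⇔ (suc c) (suc x) = mk⇔
  (λ { (s≤s cx<c) → s≤s (to (punchIn-<-pivot⇔ c x) cx<c) })
  (λ { (s≤s x<c) → s≤s (from (punchIn-<-pivot⇔ c x) x<c) })

<-inject₁⇔ : {x : Fin m} {y : Fin n} → x < inject₁ y ⇔ x < y
<-inject₁⇔ {x = x} {y} =
  mk⇔ (subst (toℕ x ℕ.<_) (Fin.toℕ-inject₁ y)) (subst (toℕ x ℕ.<_) (sym (Fin.toℕ-inject₁ y)))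

-- Z(b ∷ S) is Z(S) with a new first entry: the largest value if position 1 is a descent, and
-- otherwise the old first value, which is pushed up by one so that the relative order of the new
-- first entry with all later ones is that of the old first entry.
maxWithDes : Subset m → Perm (suc m)
maxWithDes {zero}  []          = Permutation.id
maxWithDes {suc m} (true  ∷ S) = insert zero (fromℕ (suc m)) (maxWithDes S)
maxWithDes {suc m} (false ∷ S) = insert zero (inject₁ (maxWithDes S ⟨$⟩ʳ zero)) (maxWithDes S)

maxWithDes-<⇔Separated : (S : Subset m) {i j : Fin (suc m)} → i < j →
  maxWithDes S ⟨$⟩ʳ j < maxWithDes S ⟨$⟩ʳ i ⇔ Separated S (i , j)
maxWithDes-<⇔Separated []          {zero}  {zero}  ()
maxWithDes-<⇔Separated (true  ∷ S) {suc i} {suc j} (s≤s i<j) =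
  ⇔-trans (punchIn-<⇔ _) (⇔-trans (maxWithDes-<⇔Separated S i<j) (⇔-sym separated-suc⇔))
maxWithDes-<⇔Separated (false ∷ S) {suc i} {suc j} (s≤s i<j) =
  ⇔-trans (punchIn-<⇔ _) (⇔-trans (maxWithDes-<⇔Separated S i<j) (⇔-sym separated-suc⇔))
maxWithDes-<⇔Separated (true  ∷ S) {zero}  {suc j} _ = mk⇔
  (λ _ → separated zero here z≤n (s≤s z≤n))
  (λ _ → Fin.≤∧≢⇒< (Fin.≤fromℕ _) (Fin.punchInᵢ≢i _ _))
maxWithDes-<⇔Separated (false ∷ S) {zero}  {suc j} _ =
  ⇔-trans (punchIn-<-pivot⇔ _ _) (⇔-trans <-inject₁⇔ (⇔-trans (below-first j) (⇔-sym separated-zero⇔)))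
  where
  below-first : ∀ j → maxWithDes S ⟨$⟩ʳ j < maxWithDes S ⟨$⟩ʳ zero ⇔ Separated S (zero , j)
  below-first zero    = mk⇔ (λ z0<z0 → ⊥-elim (ℕ.<-irrefl refl z0<z0))
                            (λ sep → ⊥-elim (ℕ.<-irrefl refl (separated⇒< sep)))
  below-first (suc j) = maxWithDes-<⇔Separated S (s≤s z≤n)

Inv-maxWithDes : (S : Subset m) → Inv (maxWithDes S) U.≐ Separated S
Inv-maxWithDes S =
  (λ (i<j , Zj<Zi) → to (maxWithDes-<⇔Separated S i<j) Zj<Zi) ,
  (λ sep → let i<j = separated⇒< sep in i<j , from (maxWithDes-<⇔Separated S i<j) sep)

Des-maxWithDes : (S : Subset m) → Des (maxWithDes S) ≡ S
Des-maxWithDes S = Subset.⊆-antisym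
  (λ k∈Des → to separated-adjacent⇔ (proj₁ (Inv-maxWithDes S) (adjacent (to (∈Des⇔ Z) k∈Des))))
  (λ k∈S → from (∈Des⇔ Z) (proj₂ (proj₂ (Inv-maxWithDes S) (from separated-adjacent⇔ k∈S))))
  where
  Z : Perm (suc _)
  Z = maxWithDes S
  adjacent : ∀ {k} → Z ⟨$⟩ʳ suc k < Z ⟨$⟩ʳ inject₁ k → Inv Z (inject₁ k , suc k)
  adjacent descent = Fin.≤̄⇒inject₁< Fin.≤-refl , descent

maxWithDes-isMax : (S : Subset m) → IsMaxWithDes S (maxWithDes S)
maxWithDes-isMax S = Des-maxWithDes S , λ u Des≡S →
  from (≤W⇔Inv⊆ u (maxWithDes S)) λ {p} inv →
    proj₂ (Inv-maxWithDes S) (subst (λ T → Separated T p) Des≡S (Inv⊆Separated-Des u inv))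

IsMaxWithDes⇒Inv≐Separated : {S : Subset m} (z : Perm (suc m)) → IsMaxWithDes S z → Inv z U.≐ Separated S
IsMaxWithDes⇒Inv≐Separated {S = S} z (Des≡S , maximal) =
  (λ {p} inv → subst (λ T → Separated T p) Des≡S (Inv⊆Separated-Des z inv)) ,
  (λ sep → to (≤W⇔Inv⊆ (maxWithDes S) z) (maximal (maxWithDes S) (Des-maxWithDes S))
                (proj₂ (Inv-maxWithDes S) sep))

IsMaxWithDes⇒≤W⇔⊆GDes : {S : Subset m} (z : Perm (suc m)) → IsMaxWithDes S z →
  (u : Perm (suc m)) → z ≤W u ⇔ S ⊆ GDes u
IsMaxWithDes⇒≤W⇔⊆GDes {S = S} z z-isMax u =
  ⇔-trans (≤W⇔Inv⊆ z u) (⇔-trans Inv⊆⇔Separated⊆ (Separated⊆Inv⇔⊆GDes S u))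
  where
  Inv⊆⇔Separated⊆ : Inv z U.⊆ Inv u ⇔ Separated S U.⊆ Inv u
  Inv⊆⇔Separated⊆ = mk⇔ (λ z⊆u {_} sep → z⊆u (proj₂ z≐S sep))
                        (λ S⊆u {_} inv → S⊆u (proj₁ z≐S inv))
    where
    z≐S : Inv z U.≐ Separated S
    z≐S = IsMaxWithDes⇒Inv≐Separated z z-isMax

IsMaxWithDes-mono : {S T : Subset m} (z z′ : Perm (suc m)) → IsMaxWithDes S z → IsMaxWithDes T z′ →
  S ⊆ T → z ≤W z′
IsMaxWithDes-mono {T = T} z z′ z-isMax z′-isMax S⊆T =
  from (IsMaxWithDes⇒≤W⇔⊆GDes z z-isMax z′) (T⊆GDes ∘ S⊆T)
  where
  T⊆GDes : T ⊆ GDes z′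
  T⊆GDes = to (IsMaxWithDes⇒≤W⇔⊆GDes z′ z′-isMax z′) (from (≤W⇔Inv⊆ z′ z′) id)

GDes-mono : (u v : Perm (suc m)) → u ≤W v → GDes u ⊆ GDes v
GDes-mono u v u≤v = to (Separated⊆Inv⇔⊆GDes (GDes u) v)
  λ sep → to (≤W⇔Inv⊆ u v) u≤v (from (Separated⊆Inv⇔⊆GDes (GDes u) u) id sep)

proposition1p2 : (m : ℕ) →
    -- the map Z exists (for each S the maximum permutation with descent set S)
    Σ (Subset m → Perm (suc m)) (λ Z → (S : Subset m) → IsMaxWithDes S (Z S))
    ×
    -- and (Z, GDes) is a Galois connection
    ((Z : Subset m → Perm (suc m)) → ((S : Subset m) → IsMaxWithDes S (Z S)) →
      ((S T : Subset m) → S ⊆ T → Z S ≤W Z T)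
      × ((u v : Perm (suc m)) → u ≤W v → GDes u ⊆ GDes v)
      × ((S : Subset m) (u : Perm (suc m)) →
          (Z S ≤W u → S ⊆ GDes u) × (S ⊆ GDes u → Z S ≤W u)))
proposition1p2 m = (maxWithDes , maxWithDes-isMax) , λ Z Z-isMax →
    (λ S T → IsMaxWithDes-mono (Z S) (Z T) (Z-isMax S) (Z-isMax T))
  , GDes-mono
  , λ S u → let galois = IsMaxWithDes⇒≤W⇔⊆GDes (Z S) (Z-isMax S) u in to galois , from galois
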